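{- There exists a relation $\mathcal{R} \subseteq \omega \times \omega$ satisfying the following condition $(\omega^{\diamond\diamond})$: for every $x \in \omega$ there exists a finite set $A(x)$ with $\{x\} \subseteq A(x) \subseteq \omega$ such that no map $f : A(x) \to \omega$ with $f \neq \mathrm{id}_{A(x)}$ is a homomorphism of $\mathcal{R}$.
   Context: For a relation $\mathcal{R} \subseteq A \times A$ and a subset $B \subseteq A$, a map $f : B \to A$ is called a homomorphism of $\mathcal{R}$ if for all $u, v \in B$, $(u,v) \in \mathcal{R}$ implies $(f(u), f(v)) \in \mathcal{R}$. -}

module Defs where

open import Data.Nat using (ℕ)
open import Data.List using (List)
open import Data.List.Membership.Propositional using (_∈_)
open import Data.Product using (Σ; proj₁)
open import Relation.Binary.Core using (Rel)
open import Relation.Binary.PropositionalEquality using (_≡_)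
open import Level using (0ℓ)

-- A finite subset of ω, given by a list of its elements.
-- Its elements as a type: B = { u ∈ ω | u ∈ A }.
Elem : List ℕ → Set
Elem A = Σ ℕ (λ u → u ∈ A)

IsHom : Rel ℕ 0ℓ → (A : List ℕ) → (Elem A → ℕ) → Set
IsHom R A f = ∀ (u v : Elem A) → R (proj₁ u) (proj₁ v) → R (f u) (f v)

IsId : (A : List ℕ) → (Elem A → ℕ) → Set
IsId A f = ∀ (u : Elem A) → f u ≡ proj₁ u

-- R is the successor relation on ω together with the single extra edge 0 → 2. The only
-- triangle a → b → c, a → c of R is 0 → 1 → 2, and a homomorphism maps triangles to
-- triangles, so it fixes 0, 1 and 2. Above 2 every vertex has a unique R-successor, so
-- the homomorphism fixes each further point of A(x) = {0, …, x + 2} by induction.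
module Submission where

open import Defs
open import Data.Nat using (ℕ; suc; _+_; _<_; s≤s; z≤n)
open import Data.Nat.Properties using (<-trans; n<1+n; m≤n+m)
open import Data.List using (List; upTo)
open import Data.List.Membership.Propositional using (_∈_)
open import Data.List.Membership.Propositional.Properties using (∈-upTo⁺; ∈-upTo⁻)
open import Data.Product using (Σ; _×_; _,_; proj₁; proj₂)
open import Relation.Nullary using (¬_)
open import Relation.Binary.Core using (Rel)
open import Relation.Binary.PropositionalEquality using (_≡_; refl; subst)
open import Level using (0ℓ)

data _⇝_ : Rel ℕ 0ℓ where
  step : ∀ u → u ⇝ suc u
  jump : 0 ⇝ 2

⇝-triangle : ∀ {a b c} → a ⇝ b → b ⇝ c → a ⇝ c → a ≡ 0 × b ≡ 1 × c ≡ 2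
⇝-triangle (step 0) (step 1) jump = refl , refl , refl
⇝-triangle jump (step 2) ()

⇝-from-suc-suc : ∀ {k b} → suc (suc k) ⇝ b → b ≡ suc (suc (suc k))
⇝-from-suc-suc (step _) = refl

∈-upTo-pred : ∀ {n k} → suc k ∈ upTo n → k ∈ upTo n
∈-upTo-pred p = ∈-upTo⁺ (<-trans (n<1+n _) (∈-upTo⁻ p))

module _ {n : ℕ} (2<n : 2 < n) (f : Elem (upTo n) → ℕ) (hom : IsHom _⇝_ (upTo n) f) where

  private
    _∈A : ℕ → Set
    k ∈A = k ∈ upTo n

    p₂ : 2 ∈A
    p₂ = ∈-upTo⁺ 2<n

    p₁ : 1 ∈A
    p₁ = ∈-upTo-pred p₂

    p₀ : 0 ∈A
    p₀ = ∈-upTo-pred p₁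

  -- Membership proofs are not unique, so f must be shown to fix k for every proof of k ∈ A.
  triangle-fixed : (q₀ : 0 ∈A) (q₁ : 1 ∈A) (q₂ : 2 ∈A) →
                   f (0 , q₀) ≡ 0 × f (1 , q₁) ≡ 1 × f (2 , q₂) ≡ 2
  triangle-fixed q₀ q₁ q₂ =
    ⇝-triangle (hom (0 , q₀) (1 , q₁) (step 0))
               (hom (1 , q₁) (2 , q₂) (step 1))
               (hom (0 , q₀) (2 , q₂) jump)

  hom-fixes : ∀ k (p : k ∈A) → f (k , p) ≡ k
  hom-fixes 0 p = proj₁ (triangle-fixed p p₁ p₂)
  hom-fixes 1 p = proj₁ (proj₂ (triangle-fixed p₀ p p₂))
  hom-fixes 2 p = proj₂ (proj₂ (triangle-fixed p₀ p₁ p))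
  hom-fixes (suc (suc (suc k))) p
    = ⇝-from-suc-suc (subst (_⇝ f (_ , p)) (hom-fixes _ q) (hom (_ , q) (_ , p) (step _)))
    where q = ∈-upTo-pred p

theorem7 : Σ (Rel ℕ 0ℓ) (λ R → (x : ℕ) → Σ (List ℕ) (λ A → (x ∈ A) ×
    ((f : Elem A → ℕ) → ¬ IsId A f → ¬ IsHom R A f)))
theorem7 = _⇝_ , λ x → upTo (3 + x) , ∈-upTo⁺ (x<3+x x) ,
  λ f f≢id hom → f≢id (λ (k , p) → hom-fixes (s≤s (s≤s (s≤s z≤n))) f hom k p)
  where
  x<3+x : ∀ x → x < 3 + x
  x<3+x x = s≤s (m≤n+m x 2)
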